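{- Let $\mathbf{k}$ be a commutative ring, let $\beta,\alpha\in\mathbf{k}$, and let $n$ be a positive integer. Let $\mathcal{X}=\mathbf{k}[x_{i,j}\mid 1\le i<j\le n]$ and let $\mathcal{J}\subseteq\mathcal{X}$ be the ideal generated by all elements $x_{i,j}x_{j,k}-x_{i,k}(x_{i,j}+x_{j,k}+\beta)-\alpha$ with $1\le i<j<k\le n$. Then for every $p\in\mathcal{X}$ there exists a pathless polynomial $q\in\mathcal{X}$ such that $p\equiv q\bmod\mathcal{J}$.
   Context: A monomial $\mathfrak{m}$ in the $x_{i,j}$ is pathless if there is no triple $(i,j,k)$ with $1\le i<j<k\le n$ such that $x_{i,j}x_{j,k}$ divides $\mathfrak{m}$. A polynomial in $\mathcal{X}$ is pathless if it is a $\mathbf{k}$-linear combination of pathless monomials. -}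

module Defs where

open import Level using (Level; _⊔_)
open import Algebra.Bundles using (CommutativeRing)
open import Data.Nat as ℕ using (ℕ; zero; suc)
open import Data.Fin as Fin using (Fin; _<_; _<?_)
open import Data.Fin.Properties using (all?)
open import Data.List using (List; []; _∷_; _++_; map; concatMap; foldr)
open import Data.List.Relation.Unary.All using (All)
open import Data.Product using (Σ; ∃; _×_; _,_; proj₁; proj₂)
open import Relation.Nullary using (¬_; Dec; yes; no)
open import Relation.Nullary.Decidable using (_→-dec_)
open import Relation.Binary.PropositionalEquality using (_≡_)

-- Polynomial ring X = k[x_{i,j} | i < j] over a commutative ring k,
-- variables indexed by Fin n (0-based: 0 ≤ i < j < n).
module Poly {c ℓ : Level} (R : CommutativeRing c ℓ) (n : ℕ) where
  open CommutativeRing R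

  -- Exponent vectors. Only entries (i , j) with i < j are meaningful:
  -- m i j is the exponent of x_{i,j}. Entries with i ≥ j are ignored
  -- by monomial equality below.
  Mon : Set
  Mon = Fin n → Fin n → ℕ

  _≈M_ : Mon → Mon → Set
  u ≈M v = ∀ i j → i < j → u i j ≡ v i j

  _≈M?_ : (u v : Mon) → Dec (u ≈M v)
  u ≈M? v = all? (λ i → all? (λ j → (i <? j) →-dec (u i j ℕ.≟ v i j)))

  unitM : Mon
  unitM _ _ = 0

  _⊗_ : Mon → Mon → Mon
  (u ⊗ v) i j = u i j ℕ.+ v i j

  varM : Fin n → Fin n → Mon
  varM i j k l with i Fin.≟ k | j Fin.≟ l
  ... | yes _ | yes _ = 1
  ... | _     | _     = 0

  Term : Set c
  Term = Carrier × Mon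

  Pol : Set c
  Pol = List Term

  coeff : Pol → Mon → Carrier
  coeff [] m = 0#
  coeff ((a , u) ∷ p) m with u ≈M? m
  ... | yes _ = a + coeff p m
  ... | no  _ = coeff p m

  _≈P_ : Pol → Pol → Set ℓ
  p ≈P q = ∀ m → coeff p m ≈ coeff q m

  _+P_ : Pol → Pol → Pol
  p +P q = p ++ q

  -P_ : Pol → Pol
  -P p = map (λ t → (- proj₁ t , proj₂ t)) p

  _-P_ : Pol → Pol → Pol
  p -P q = p +P (-P q)

  _*P_ : Pol → Pol → Pol
  p *P q = concatMap (λ t → map (λ s → (proj₁ t * proj₁ s , proj₂ t ⊗ proj₂ s)) q) p

  constP : Carrier → Pol
  constP a = (a , unitM) ∷ []

  x : Fin n → Fin n → Pol
  x i j = (1# , varM i j) ∷ []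

  sumP : List Pol → Pol
  sumP = foldr _+P_ []

  gen : (β α : Carrier) → Fin n → Fin n → Fin n → Pol
  gen β α i j k =
    ((x i j *P x j k) -P (x i k *P ((x i j +P x j k) +P constP β))) -P constP α

  Triple : Set
  Triple = Fin n × Fin n × Fin n

  Increasing : Triple → Set
  Increasing (i , j , k) = (i < j) × (j < k)

  InJ : (β α : Carrier) → Pol → Set (c ⊔ ℓ)
  InJ β α p = Σ (List (Pol × Triple)) λ cs →
    All (λ rt → Increasing (proj₂ rt)) cs ×
    (p ≈P sumP (map (λ rt → proj₁ rt *P gen β α (proj₁ (proj₂ rt)) (proj₁ (proj₂ (proj₂ rt))) (proj₂ (proj₂ (proj₂ rt)))) cs))

  CongJ : (β α : Carrier) → Pol → Pol → Set (c ⊔ ℓ)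
  CongJ β α p q = InJ β α (p -P q)

  PathlessM : Mon → Set
  PathlessM m = ∀ i j k → i < j → j < k → ¬ ((1 ℕ.≤ m i j) × (1 ℕ.≤ m j k))

  Pathless : Pol → Set c
  Pathless p = All (λ t → PathlessM (proj₂ t)) p

-- Orient each generator as the rewriting rule
--   x_{i,j} x_{j,k} ⟶ x_{i,k} (x_{i,j} + x_{j,k} + β) + α      (i < j < k),
-- so that a monomial divisible by a path x_{i,j} x_{j,k} is congruent modulo J
-- to the corresponding four monomials.  Weighting x_{p,q} by (n − q) + p makes
-- x_{i,k} strictly lighter than both x_{i,j} and x_{j,k}, so every rewrite
-- strictly lowers the weighted degree and rewriting terminates in a pathless
-- polynomial.
module Submission where

open import Defs
open import Algebra.Bundles using (CommutativeRing)
open import Data.Nat using (ℕ; _≤_)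
open import Data.Product using (Σ; _×_)

open import Level using (_⊔_)
open import Data.Nat as ℕ using (zero; suc; z≤n)
open import Data.Nat.Properties as ℕ using (+-0-commutativeMonoid)
open import Data.Nat.Induction using (<-wellFounded)
open import Data.Fin as Fin using (Fin; toℕ; punchIn)
open import Data.Fin.Properties using (any?; _<?_; <⇒≢; toℕ<n; toℕ≤n; punchInᵢ≢i)
open import Data.Vec.Functional using (Vector)
open import Data.List using (List; []; _∷_; _++_; map)
open import Data.List.Properties using (map-++; concat-++; ++-assoc; ++-identityʳ)
open import Data.List.Relation.Unary.All as All using (All; []; _∷_)
open import Data.List.Relation.Unary.All.Properties using (++⁺)
open import Data.Product using (∃; _,_; proj₁; proj₂)
open import Data.Empty using (⊥-elim)
open import Function using (_∘_; _on_)
open import Induction.WellFounded using (WfRec)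
import Induction.WellFounded as WF
open import Relation.Binary using (Setoid)
import Relation.Binary.Construct.On as On
import Relation.Binary.Reasoning.Setoid
open import Relation.Nullary using (¬_; Dec; yes; no)
open import Relation.Nullary.Decidable using (_×-dec_)
open import Relation.Binary.PropositionalEquality as ≡ using (_≡_; _≢_)

open import Algebra.Properties.CommutativeMonoid.Sum +-0-commutativeMonoid
  using (sum; sum-remove; sum-cong-≗; sum-replicate-zero; ∑-distrib-+)

sum-zero : ∀ {m} (f : Vector ℕ m) → (∀ k → f k ≡ 0) → sum f ≡ 0
sum-zero {m} f f≡0 = ≡.trans (sum-cong-≗ f≡0) (sum-replicate-zero m)

sum-δ : ∀ {m} (f : Vector ℕ m) (i : Fin m) → (∀ k → k ≢ i → f k ≡ 0) → sum f ≡ f i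
sum-δ {zero} f () _
sum-δ {suc m} f i f≡0 = begin
  sum f                               ≡⟨ sum-remove f ⟩
  f i ℕ.+ sum (λ k → f (punchIn i k)) ≡⟨ ≡.cong (f i ℕ.+_) (sum-zero _ (λ k → f≡0 _ (punchInᵢ≢i i k))) ⟩
  f i ℕ.+ 0                           ≡⟨ ℕ.+-identityʳ (f i) ⟩
  f i                                 ∎
  where open ≡.≡-Reasoning

module PolyProperties {c ℓ} (R : CommutativeRing c ℓ) (n : ℕ) where
  open CommutativeRing R
  open Poly R n
  open import Algebra.Properties.Ring ring using (-0#≈0#; -‿distribʳ-*)
  open import Algebra.Properties.AbelianGroup +-abelianGroup using (⁻¹-∙-comm)
  open import Algebra.Properties.CommutativeSemigroup +-commutativeSemigroup using (interchange)

  module ≈-Reasoning = Relation.Binary.Reasoning.Setoid setoid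

  _≗M_ : Mon → Mon → Set
  u ≗M v = ∀ p q → u p q ≡ v p q

  ≈M-sym : ∀ {u v} → u ≈M v → v ≈M u
  ≈M-sym u≈v i j i<j = ≡.sym (u≈v i j i<j)

  ≈M-trans : ∀ {u v w} → u ≈M v → v ≈M w → u ≈M w
  ≈M-trans u≈v v≈w i j i<j = ≡.trans (u≈v i j i<j) (v≈w i j i<j)

  varM-diag : ∀ i j → varM i j i j ≡ 1
  varM-diag i j with i Fin.≟ i | j Fin.≟ j
  ... | yes _ | yes _  = ≡.refl
  ... | no i≢i | _     = ⊥-elim (i≢i ≡.refl)
  ... | yes _ | no j≢j = ⊥-elim (j≢j ≡.refl)

  varM-off : ∀ i j p q → ¬ (i ≡ p × j ≡ q) → varM i j p q ≡ 0
  varM-off i j p q ≢ij with i Fin.≟ p | j Fin.≟ q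
  ... | yes i≡p | yes j≡q = ⊥-elim (≢ij (i≡p , j≡q))
  ... | no _    | _       = ≡.refl
  ... | yes _   | no _    = ≡.refl

  _∣M_ : Mon → Mon → Set
  v ∣M u = ∀ p q → v p q ≤ u p q

  _∸M_ : Mon → Mon → Mon
  (u ∸M v) p q = u p q ℕ.∸ v p q

  ∸M-⊗ : ∀ {u v} → v ∣M u → u ≗M ((u ∸M v) ⊗ v)
  ∸M-⊗ v∣u p q = ≡.sym (ℕ.m∸n+n≡m (v∣u p q))

  Path : Mon → Set
  Path u = ∃ λ i → ∃ λ j → ∃ λ k → i Fin.< j × j Fin.< k × 1 ≤ u i j × 1 ≤ u j k

  path? : ∀ u → Dec (Path u)
  path? u = any? λ i → any? λ j → any? λ k →
    (i <? j) ×-dec (j <? k) ×-dec (1 ℕ.≤? u i j) ×-dec (1 ℕ.≤? u j k)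

  ¬path⇒pathless : ∀ {u} → ¬ Path u → PathlessM u
  ¬path⇒pathless ¬path i j k i<j j<k (uij , ujk) = ¬path (i , j , k , i<j , j<k , uij , ujk)

  path-∣M : ∀ {u i j k} → i Fin.< j → 1 ≤ u i j → 1 ≤ u j k → (varM i j ⊗ varM j k) ∣M u
  path-∣M {u} {i} {j} {k} i<j uij ujk p q
    with (i Fin.≟ p) ×-dec (j Fin.≟ q) | (j Fin.≟ p) ×-dec (k Fin.≟ q)
  ... | yes (≡.refl , ≡.refl) | _
    rewrite varM-diag i j | varM-off j k i j (λ (j≡i , _) → <⇒≢ i<j (≡.sym j≡i)) = uij
  ... | no ≢ij | yes (≡.refl , ≡.refl)
    rewrite varM-off i j j k ≢ij | varM-diag j k = ujk
  ... | no ≢ij | no ≢jk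
    rewrite varM-off i j p q ≢ij | varM-off j k p q ≢jk = z≤n

  weight : Fin n → Fin n → ℕ
  weight p q = (n ℕ.∸ toℕ q) ℕ.+ toℕ p

  weight-monoˡ-< : ∀ {i j} k → i Fin.< j → weight i k ℕ.< weight j k
  weight-monoˡ-< k i<j = ℕ.+-monoʳ-< (n ℕ.∸ toℕ k) i<j

  weight-antimonoʳ-< : ∀ i {j k} → j Fin.< k → weight i k ℕ.< weight i j
  weight-antimonoʳ-< i {k = k} j<k = ℕ.+-monoˡ-< (toℕ i) (ℕ.∸-monoʳ-< j<k (toℕ≤n k))

  weight-positive : ∀ i j → 0 ℕ.< weight i j
  weight-positive i j = ℕ.≤-trans (ℕ.m<n⇒0<n∸m (toℕ<n j)) (ℕ.m≤m+n _ _)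

  -- Junk entries (p ≥ q) are counted too, so degree respects ≗M but not ≈M.
  degree : Mon → ℕ
  degree u = sum λ p → sum λ q → u p q ℕ.* weight p q

  degree-cong : ∀ {u v} → u ≗M v → degree u ≡ degree v
  degree-cong u≗v = sum-cong-≗ λ p → sum-cong-≗ λ q → ≡.cong (ℕ._* weight p q) (u≗v p q)

  degree-⊗ : ∀ u v → degree (u ⊗ v) ≡ degree u ℕ.+ degree v
  degree-⊗ u v = ≡.trans
    (sum-cong-≗ λ p → ≡.trans
      (sum-cong-≗ λ q → ℕ.*-distribʳ-+ (weight p q) (u p q) (v p q))
      (∑-distrib-+ (λ q → u p q ℕ.* weight p q) (λ q → v p q ℕ.* weight p q)))
    (∑-distrib-+ (λ p → sum λ q → u p q ℕ.* weight p q) (λ p → sum λ q → v p q ℕ.* weight p q))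

  degree-⊗-monoʳ-< : ∀ u {v w} → degree v ℕ.< degree w → degree (u ⊗ v) ℕ.< degree (u ⊗ w)
  degree-⊗-monoʳ-< u {v} {w} v<w = ≡.subst₂ ℕ._<_ (≡.sym (degree-⊗ u v)) (≡.sym (degree-⊗ u w))
    (ℕ.+-monoʳ-< (degree u) v<w)

  degree-unitM : degree unitM ≡ 0
  degree-unitM = sum-zero {n} _ λ p → sum-zero {n} _ λ q → ≡.refl

  degree-varM : ∀ i j → degree (varM i j) ≡ weight i j
  degree-varM i j = begin
    degree (varM i j)
      ≡⟨ sum-δ _ i (λ p p≢i → sum-zero _ λ q →
           ≡.cong (ℕ._* weight p q) (varM-off i j p q (p≢i ∘ ≡.sym ∘ proj₁))) ⟩
    sum (λ q → varM i j i q ℕ.* weight i q)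
      ≡⟨ sum-δ _ j (λ q q≢j → ≡.cong (ℕ._* weight i q) (varM-off i j i q (q≢j ∘ ≡.sym ∘ proj₂))) ⟩
    varM i j i j ℕ.* weight i j
      ≡⟨ ≡.cong (ℕ._* weight i j) (varM-diag i j) ⟩
    1 ℕ.* weight i j
      ≡⟨ ℕ.*-identityˡ (weight i j) ⟩
    weight i j ∎
    where open ≡.≡-Reasoning

  degree-varM-⊗ : ∀ i j i′ j′ → degree (varM i j ⊗ varM i′ j′) ≡ weight i j ℕ.+ weight i′ j′
  degree-varM-⊗ i j i′ j′ =
    ≡.trans (degree-⊗ (varM i j) (varM i′ j′)) (≡.cong₂ ℕ._+_ (degree-varM i j) (degree-varM i′ j′))

  ∷-cong : ∀ {a b u v p q} → a ≈ b → u ≈M v → p ≈P q → ((a , u) ∷ p) ≈P ((b , v) ∷ q)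
  ∷-cong {u = u} {v} a≈b u≈v p≈q m with u ≈M? m | v ≈M? m
  ... | yes _   | yes _   = +-cong a≈b (p≈q m)
  ... | no _    | no _    = p≈q m
  ... | yes u≈m | no v≉m  = ⊥-elim (v≉m (≈M-trans (≈M-sym u≈v) u≈m))
  ... | no u≉m  | yes v≈m = ⊥-elim (u≉m (≈M-trans u≈v v≈m))

  coeff-+P : ∀ p q m → coeff (p +P q) m ≈ coeff p m + coeff q m
  coeff-+P [] q m = sym (+-identityˡ _)
  coeff-+P ((a , u) ∷ p) q m with u ≈M? m
  ... | yes _ = trans (+-congˡ (coeff-+P p q m)) (sym (+-assoc _ _ _))
  ... | no _  = coeff-+P p q m

  coeff-negP : ∀ p m → coeff (-P p) m ≈ - coeff p m
  coeff-negP [] m = sym -0#≈0#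
  coeff-negP ((a , u) ∷ p) m with u ≈M? m
  ... | yes _ = trans (+-congˡ (coeff-negP p m)) (⁻¹-∙-comm a (coeff p m))
  ... | no _  = coeff-negP p m

  coeff-subP : ∀ p q m → coeff (p -P q) m ≈ coeff p m - coeff q m
  coeff-subP p q m = trans (coeff-+P p (-P q) m) (+-congˡ (coeff-negP q m))

  ≈P-setoid : Setoid c ℓ
  ≈P-setoid = record
    { Carrier       = Pol
    ; _≈_           = _≈P_
    ; isEquivalence = record
      { refl  = λ m → refl
      ; sym   = λ p≈q m → sym (p≈q m)
      ; trans = λ p≈q q≈r m → trans (p≈q m) (q≈r m)
      }
    }

  open Setoid ≈P-setoid using ()
    renaming (reflexive to ≈P-reflexive)

  module ≈P-Reasoning = Relation.Binary.Reasoning.Setoid ≈P-setoid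

  -- _≈P_ unfolds to a statement about coeff, which is not injective, so the
  -- polynomials in the congruence lemmas below cannot be inferred and are explicit.
  +P-cong : ∀ p p′ {q q′} → p ≈P p′ → q ≈P q′ → (p +P q) ≈P (p′ +P q′)
  +P-cong p p′ {q} {q′} p≈p′ q≈q′ m =
    trans (coeff-+P p q m) (trans (+-cong (p≈p′ m) (q≈q′ m)) (sym (coeff-+P p′ q′ m)))

  +P-congˡ : ∀ p {q q′} → q ≈P q′ → (p +P q) ≈P (p +P q′)
  +P-congˡ p = +P-cong p p λ _ → refl

  negP-cong : ∀ p q → p ≈P q → (-P p) ≈P (-P q)
  negP-cong p q p≈q m = trans (coeff-negP p m) (trans (-‿cong (p≈q m)) (sym (coeff-negP q m)))

  +P-interchange : ∀ p q r s → ((p +P q) +P (r +P s)) ≈P ((p +P r) +P (q +P s))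
  +P-interchange p q r s m = begin
    coeff ((p +P q) +P (r +P s)) m
      ≈⟨ trans (coeff-+P (p +P q) (r +P s) m) (+-cong (coeff-+P p q m) (coeff-+P r s m)) ⟩
    (coeff p m + coeff q m) + (coeff r m + coeff s m)
      ≈⟨ interchange _ _ _ _ ⟩
    (coeff p m + coeff r m) + (coeff q m + coeff s m)
      ≈⟨ sym (trans (coeff-+P (p +P r) (q +P s) m) (+-cong (coeff-+P p r m) (coeff-+P q s m))) ⟩
    coeff ((p +P r) +P (q +P s)) m ∎
    where open ≈-Reasoning

  subP-inverse : ∀ p → (p -P p) ≈P []
  subP-inverse p m = trans (coeff-subP p p m) (-‿inverseʳ (coeff p m))

  subP-telescope : ∀ p q s → (p -P s) ≈P ((p -P q) +P (q -P s))
  subP-telescope p q s m = begin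
    coeff (p -P s) m                     ≈⟨ coeff-subP p s m ⟩
    P - S                                ≈⟨ +-congʳ (sym (+-identityʳ P)) ⟩
    (P + 0#) - S                         ≈⟨ +-congʳ (+-congˡ (sym (-‿inverseˡ Q))) ⟩
    (P + (- Q + Q)) - S                  ≈⟨ +-congʳ (sym (+-assoc P (- Q) Q)) ⟩
    ((P - Q) + Q) - S                    ≈⟨ +-assoc (P - Q) Q (- S) ⟩
    (P - Q) + (Q - S)                    ≈⟨ sym (+-cong (coeff-subP p q m) (coeff-subP q s m)) ⟩
    coeff (p -P q) m + coeff (q -P s) m  ≈⟨ sym (coeff-+P (p -P q) (q -P s) m) ⟩
    coeff ((p -P q) +P (q -P s)) m       ∎
    where
      open ≈-Reasoning
      P = coeff p m
      Q = coeff q m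
      S = coeff s m

  subP-interchange : ∀ p p′ q q′ → ((p +P p′) -P (q +P q′)) ≈P ((p -P q) +P (p′ -P q′))
  subP-interchange p p′ q q′ = begin
    (p +P p′) -P (q +P q′)           ≈⟨ +P-congˡ (p +P p′) (≈P-reflexive (map-++ _ q q′)) ⟩
    (p +P p′) +P ((-P q) +P (-P q′)) ≈⟨ +P-interchange p p′ (-P q) (-P q′) ⟩
    (p -P q) +P (p′ -P q′)           ∎
    where open ≈P-Reasoning

  subP-assoc : ∀ p q s → ((p -P q) -P s) ≈P (p -P (q +P s))
  subP-assoc p q s = begin
    (p -P q) -P s              ≈⟨ ≈P-reflexive (++-assoc p (-P q) (-P s)) ⟩
    p +P ((-P q) +P (-P s))    ≈⟨ +P-congˡ p (≈P-reflexive (≡.sym (map-++ _ q s))) ⟩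
    p -P (q +P s)              ∎
    where open ≈P-Reasoning

  -- (t ∷ r) *P p reduces to (t ·P p) +P (r *P p).
  _·P_ : Term → Pol → Pol
  (a , u) ·P p = map (λ (b , v) → a * b , u ⊗ v) p

  ·P-negʳ : ∀ t p → (t ·P (-P p)) ≈P (-P (t ·P p))
  ·P-negʳ t [] = λ _ → refl
  ·P-negʳ (a , u) ((b , v) ∷ p) = ∷-cong (sym (-‿distribʳ-* a b)) (λ _ _ _ → ≡.refl) (·P-negʳ (a , u) p)

  *P-negʳ : ∀ r p → (r *P (-P p)) ≈P (-P (r *P p))
  *P-negʳ [] p = λ _ → refl
  *P-negʳ (t ∷ r) p = begin
    (t ·P (-P p)) +P (r *P (-P p))  ≈⟨ +P-cong (t ·P (-P p)) (-P (t ·P p)) (·P-negʳ t p) (*P-negʳ r p) ⟩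
    (-P (t ·P p)) +P (-P (r *P p))  ≈⟨ ≈P-reflexive (≡.sym (map-++ _ (t ·P p) (r *P p))) ⟩
    -P ((t ·P p) +P (r *P p))       ∎
    where open ≈P-Reasoning

  *P-distribˡ-+P : ∀ r p q → (r *P (p +P q)) ≈P ((r *P p) +P (r *P q))
  *P-distribˡ-+P [] p q = λ _ → refl
  *P-distribˡ-+P (t ∷ r) p q = begin
    (t ·P (p +P q)) +P (r *P (p +P q))
      ≈⟨ +P-cong (t ·P (p +P q)) ((t ·P p) +P (t ·P q)) (≈P-reflexive (map-++ _ p q)) (*P-distribˡ-+P r p q) ⟩
    ((t ·P p) +P (t ·P q)) +P ((r *P p) +P (r *P q))
      ≈⟨ +P-interchange (t ·P p) (t ·P q) (r *P p) (r *P q) ⟩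
    ((t ·P p) +P (r *P p)) +P ((t ·P q) +P (r *P q)) ∎
    where open ≈P-Reasoning

  *P-distribˡ-subP : ∀ r p q → (r *P (p -P q)) ≈P ((r *P p) -P (r *P q))
  *P-distribˡ-subP r p q = begin
    r *P (p -P q)                ≈⟨ *P-distribˡ-+P r p (-P q) ⟩
    (r *P p) +P (r *P (-P q))    ≈⟨ +P-congˡ (r *P p) (*P-negʳ r q) ⟩
    (r *P p) -P (r *P q)         ∎
    where open ≈P-Reasoning

  module Ideal (β α : Carrier) where

    multiple : Pol × Triple → Pol
    multiple (r , i , j , k) = r *P gen β α i j k

    combination : List (Pol × Triple) → Pol
    combination cs = sumP (map multiple cs)

    combination-++ : ∀ cs ds → combination (cs ++ ds) ≡ combination cs +P combination ds
    combination-++ cs ds =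
      ≡.trans (≡.cong sumP (map-++ multiple cs ds)) (≡.sym (concat-++ (map multiple cs) (map multiple ds)))

    InJ-resp : ∀ p q → p ≈P q → InJ β α q → InJ β α p
    InJ-resp _ _ p≈q (cs , inc , q≈) = cs , inc , λ m → trans (p≈q m) (q≈ m)

    InJ-+P : ∀ p q → InJ β α p → InJ β α q → InJ β α (p +P q)
    InJ-+P p q (cs , cs-inc , p≈) (ds , ds-inc , q≈) = cs ++ ds , ++⁺ cs-inc ds-inc , λ m → begin
      coeff (p +P q) m
        ≈⟨ +P-cong p (combination cs) p≈ q≈ m ⟩
      coeff (combination cs +P combination ds) m
        ≈⟨ reflexive (≡.cong (λ s → coeff s m) (≡.sym (combination-++ cs ds))) ⟩
      coeff (combination (cs ++ ds)) m ∎
      where open ≈-Reasoning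

    CongJ-refl : ∀ p → CongJ β α p p
    CongJ-refl p = InJ-resp (p -P p) [] (subP-inverse p) ([] , [] , λ _ → refl)

    CongJ-trans : ∀ p q s → CongJ β α p q → CongJ β α q s → CongJ β α p s
    CongJ-trans p q s p≡q q≡s =
      InJ-resp (p -P s) ((p -P q) +P (q -P s)) (subP-telescope p q s) (InJ-+P (p -P q) (q -P s) p≡q q≡s)

    CongJ-+P : ∀ p p′ q q′ → CongJ β α p q → CongJ β α p′ q′ → CongJ β α (p +P p′) (q +P q′)
    CongJ-+P p p′ q q′ p≡q p′≡q′ =
      InJ-resp ((p +P p′) -P (q +P q′)) ((p -P q) +P (p′ -P q′)) (subP-interchange p p′ q q′)
        (InJ-+P (p -P q) (p′ -P q′) p≡q p′≡q′)

    replacement : Fin n → Fin n → Fin n → Pol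
    replacement i j k = (x i k *P ((x i j +P x j k) +P constP β)) +P constP α

    *P-gen : ∀ r i j k → (r *P gen β α i j k) ≈P ((r *P (x i j *P x j k)) -P (r *P replacement i j k))
    *P-gen r i j k = begin
      r *P ((A -P B) -P C)
        ≈⟨ *P-distribˡ-subP r (A -P B) C ⟩
      (r *P (A -P B)) -P (r *P C)
        ≈⟨ +P-cong (r *P (A -P B)) ((r *P A) -P (r *P B)) (*P-distribˡ-subP r A B) (λ _ → refl) ⟩
      ((r *P A) -P (r *P B)) -P (r *P C)
        ≈⟨ subP-assoc (r *P A) (r *P B) (r *P C) ⟩
      (r *P A) -P ((r *P B) +P (r *P C))
        ≈⟨ +P-congˡ (r *P A)
             (negP-cong ((r *P B) +P (r *P C)) (r *P (B +P C)) (λ m → sym (*P-distribˡ-+P r B C m))) ⟩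
      (r *P A) -P (r *P (B +P C)) ∎
      where
        open ≈P-Reasoning
        A = x i j *P x j k
        B = x i k *P ((x i j +P x j k) +P constP β)
        C = constP α

    CongJ-rewrite : ∀ a {u} u′ {i j k} → Increasing (i , j , k) → u ≈M (u′ ⊗ (varM i j ⊗ varM j k)) →
      CongJ β α ((a , u) ∷ []) (((a , u′) ∷ []) *P replacement i j k)
    CongJ-rewrite a {u} u′ {i} {j} {k} inc u≈ = (r , i , j , k) ∷ [] , inc ∷ [] , (begin
      ((a , u) ∷ []) -P (r *P replacement i j k)
        ≈⟨ +P-cong ((a , u) ∷ []) (r *P (x i j *P x j k))
             (∷-cong (sym a·1·1≈a) u≈ (λ _ → refl)) (λ _ → refl) ⟩
      (r *P (x i j *P x j k)) -P (r *P replacement i j k)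
        ≈⟨ (λ m → sym (*P-gen r i j k m)) ⟩
      r *P gen β α i j k
        ≈⟨ ≈P-reflexive (≡.sym (++-identityʳ (r *P gen β α i j k))) ⟩
      combination ((r , i , j , k) ∷ []) ∎)
      where
        open ≈P-Reasoning
        r = (a , u′) ∷ []
        a·1·1≈a : a * (1# * 1#) ≈ a
        a·1·1≈a = trans (*-congˡ (*-identityʳ 1#)) (*-identityʳ a)

    replacement-lighter : ∀ a u′ {i j k} → i Fin.< j → j Fin.< k →
      All (λ t → degree (proj₂ t) ℕ.< degree (u′ ⊗ (varM i j ⊗ varM j k)))
          (((a , u′) ∷ []) *P replacement i j k)
    replacement-lighter a u′ {i} {j} {k} i<j j<k =
      lighter (begin-strict
        degree (varM i k ⊗ varM i j) ≡⟨ degree-varM-⊗ i k i j ⟩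
        weight i k ℕ.+ weight i j    <⟨ ℕ.+-monoˡ-< (weight i j) ik<jk ⟩
        weight j k ℕ.+ weight i j    ≡⟨ ℕ.+-comm (weight j k) (weight i j) ⟩
        weight i j ℕ.+ weight j k    ∎) ∷
      lighter (begin-strict
        degree (varM i k ⊗ varM j k) ≡⟨ degree-varM-⊗ i k j k ⟩
        weight i k ℕ.+ weight j k    <⟨ ℕ.+-monoˡ-< (weight j k) ik<ij ⟩
        weight i j ℕ.+ weight j k    ∎) ∷
      lighter (begin-strict
        degree (varM i k ⊗ unitM)    ≡⟨ degree-⊗ (varM i k) unitM ⟩
        degree (varM i k) ℕ.+ degree unitM
                                     ≡⟨ ≡.cong₂ ℕ._+_ (degree-varM i k) degree-unitM ⟩
        weight i k ℕ.+ 0             ≡⟨ ℕ.+-identityʳ (weight i k) ⟩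
        weight i k                   <⟨ ik<jk ⟩
        weight j k                   ≤⟨ ℕ.m≤n+m (weight j k) (weight i j) ⟩
        weight i j ℕ.+ weight j k    ∎) ∷
      lighter (begin-strict
        degree unitM                 ≡⟨ degree-unitM ⟩
        0                            <⟨ weight-positive i j ⟩
        weight i j                   ≤⟨ ℕ.m≤m+n (weight i j) (weight j k) ⟩
        weight i j ℕ.+ weight j k    ∎) ∷ []
      where
        open ℕ.≤-Reasoning
        ik<jk : weight i k ℕ.< weight j k
        ik<jk = weight-monoˡ-< k i<j
        ik<ij : weight i k ℕ.< weight i j
        ik<ij = weight-antimonoʳ-< i j<k
        lighter : ∀ {v} → degree v ℕ.< weight i j ℕ.+ weight j k →
          degree (u′ ⊗ v) ℕ.< degree (u′ ⊗ (varM i j ⊗ varM j k))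
        lighter v< = degree-⊗-monoʳ-< u′ (≡.subst (_ ℕ.<_) (≡.sym (degree-varM-⊗ i j j k)) v<)

    Reduces : Pol → Set (c ⊔ ℓ)
    Reduces p = Σ Pol λ q → Pathless q × CongJ β α p q

    reduces-+P : ∀ p q → Reduces p → Reduces q → Reduces (p +P q)
    reduces-+P p q (p′ , p′-pathless , p≡p′) (q′ , q′-pathless , q≡q′) =
      p′ +P q′ , ++⁺ p′-pathless q′-pathless , CongJ-+P p q p′ q′ p≡p′ q≡q′

    reduces-all : ∀ {p} → All (λ t → Reduces (t ∷ [])) p → Reduces p
    reduces-all []                = [] , [] , CongJ-refl []
    reduces-all {t ∷ p} (t↓ ∷ p↓) = reduces-+P (t ∷ []) p t↓ (reduces-all p↓)

    reduces-term : ∀ t → Reduces (t ∷ [])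
    reduces-term = WF.All.wfRec (On.wellFounded (degree ∘ proj₂) <-wellFounded) (c ⊔ ℓ)
      (λ t → Reduces (t ∷ [])) rewrite-path
      where
        rewrite-path : ∀ t → WfRec (ℕ._<_ on (degree ∘ proj₂)) (λ s → Reduces (s ∷ [])) t → Reduces (t ∷ [])
        rewrite-path (a , u) reduces-lighter with path? u
        ... | no ¬path = (a , u) ∷ [] , ¬path⇒pathless ¬path ∷ [] , CongJ-refl ((a , u) ∷ [])
        ... | yes (i , j , k , i<j , j<k , uij , ujk) =
          let q , q-pathless , replaced≡q =
                reduces-all (All.map (reduces-lighter ∘ ≡.subst (_ ℕ.<_) (≡.sym (degree-cong u≗)))
                                     (replacement-lighter a u′ i<j j<k))
          in q , q-pathless ,
             CongJ-trans ((a , u) ∷ []) replaced q (CongJ-rewrite a u′ (i<j , j<k) (λ p q _ → u≗ p q)) replaced≡q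
          where
            u′ = u ∸M (varM i j ⊗ varM j k)
            replaced = ((a , u′) ∷ []) *P replacement i j k
            u≗ : u ≗M (u′ ⊗ (varM i j ⊗ varM j k))
            u≗ = ∸M-⊗ (path-∣M i<j uij ujk)

    reduces : ∀ p → Reduces p
    reduces p = reduces-all (All.universal reduces-term p)

proposition2p5 : ∀ {c ℓ} (R : CommutativeRing c ℓ) (β α : CommutativeRing.Carrier R) (n : ℕ) → 1 ≤ n →
    (p : Poly.Pol R n) → Σ (Poly.Pol R n) (λ q → Poly.Pathless R n q × Poly.CongJ R n β α p q)
proposition2p5 R β α n _ = reduces
  where open PolyProperties.Ideal R n β α
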